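{- Let $G$ be an identifiable block graph. Then $\gamma^{ID}(G)\leq n_Q(G)$.
   Context: All graphs are finite and simple. A block graph is a graph in which every maximal 2-connected subgraph (block) is a clique. For a vertex $u$, $N(u)$ is its open neighborhood and $N[u]=N(u)\cup\{u\}$ its closed neighborhood. A set $C\subseteq V(G)$ is an identifying code (ID-code) of $G$ if $N[u]\cap C\neq\emptyset$ for all $u\in V(G)$ and $N[u]\cap C\neq N[v]\cap C$ for all distinct $u,v\in V(G)$. $G$ is identifiable if it admits an identifying code (equivalently, $G$ has no two distinct vertices $u,v$ with $N[u]=N[v]$). $\gamma^{ID}(G)$ is the minimum cardinality of an identifying code of $G$. $n_Q(G)$ denotes the number of maximal cliques of $G$. -}

module Defs where

open import Data.Nat using (ℕ; _≤_)
open import Data.Bool using (Bool; true; false)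
open import Data.Fin using (Fin)
open import Data.Fin.Subset using (Subset; _∈_; _⊆_; ∣_∣; _-_)
open import Data.Sum using (_⊎_)
open import Data.Product using (Σ; ∃; _×_; _,_)
open import Data.List using (List; length)
import Data.List.Membership.Propositional as L
open import Data.List.Relation.Unary.Unique.Propositional using (Unique)
open import Relation.Binary.PropositionalEquality using (_≡_; _≢_)
open import Relation.Nullary using (¬_)
open import Function.Bundles using (_⇔_)

record Graph (n : ℕ) : Set where
  field
    adj     : Fin n → Fin n → Bool
    sym     : ∀ u v → adj u v ≡ adj v u
    irrefl  : ∀ u → adj u u ≡ false

module _ {n : ℕ} (G : Graph n) where
  open Graph G

  Adj : Fin n → Fin n → Set
  Adj u v = adj u v ≡ true

  ClosedAdj : Fin n → Fin n → Set
  ClosedAdj u v = (u ≡ v) ⊎ Adj u v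

  data PathIn (S : Subset n) : Fin n → Fin n → Set where
    here : ∀ {u} → u ∈ S → PathIn S u u
    step : ∀ {u v w} → u ∈ S → Adj u v → PathIn S v w → PathIn S u w

  ConnectedIn : Subset n → Set
  ConnectedIn S = ∀ u v → u ∈ S → v ∈ S → PathIn S u v

  Without : Subset n → Fin n → Subset n
  Without S v = S - v

  Biconnected : Subset n → Set
  Biconnected S = ConnectedIn S × (∀ v → v ∈ S → ConnectedIn (Without S v))

  IsBlock : Subset n → Set
  IsBlock S = (∃ λ v → v ∈ S) × Biconnected S
              × (∀ T → S ⊆ T → Biconnected T → T ⊆ S)

  IsClique : Subset n → Set
  IsClique S = ∀ u v → u ∈ S → v ∈ S → u ≢ v → Adj u v

  IsMaximalClique : Subset n → Set
  IsMaximalClique S = (∃ λ v → v ∈ S) × IsClique S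
                      × (∀ T → IsClique T → S ⊆ T → T ⊆ S)

  IsBlockGraph : Set
  IsBlockGraph = ∀ S → IsBlock S → IsClique S

  IsIDCode : Subset n → Set
  IsIDCode C = (∀ u → ∃ λ v → v ∈ C × ClosedAdj u v)
             × (∀ u v → u ≢ v →
                  ¬ (∀ w → (w ∈ C × ClosedAdj u w) ⇔ (w ∈ C × ClosedAdj v w)))

  Identifiable : Set
  Identifiable = ∃ λ C → IsIDCode C

  -- L is a duplicate-free list of exactly the maximal cliques of G,
  -- so length L = n_Q(G).
  EnumeratesMaxCliques : List (Subset n) → Set
  EnumeratesMaxCliques Ls = Unique Ls × (∀ S → (S L.∈ Ls) ⇔ IsMaximalClique S)

  γID≤ : ℕ → Set
  γID≤ k = ∃ λ C → IsIDCode C × ∣ C ∣ ≤ k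

module Submission where

-- An induction over the twin-free induced subgraphs G[S] produces an identifying code C of G[S]
-- together with ∣ C ∣ distinct maximal cliques of G[S].  In a block graph every cycle lies in a
-- block and therefore induces a clique; consequently the first vertex s of a longest path of G[S]
-- has at most one neighbour, since otherwise s and its successor on the path would be closed twins.
-- If s is isolated, recurse on S - s and add s to the code and {s} to the cliques.  If s is pendant
-- with neighbour x, add {x, s} to the cliques: when G[S - s] is twin-free, recurse on it and add s
-- or a neighbour of x to the code; otherwise x has a closed twin t in S - s, and one recurses on
-- S - s - x, adds s to the code and puts x back into the maximal cliques to which it is complete.
-- The classical choices (longest paths, blocks, excluded middle) are made in the double-negation
-- monad, which suffices because having an identifying code of a given size is decidable.

open import Defs
open import Data.Nat using (ℕ; zero; suc; _+_; _≤_; _<_; _≤?_; z≤n; s≤s)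
open import Data.Nat.Properties
  using (<⇒≱; 1+n≰n; n≮0; <-≤-trans; ≤-pred; ≤-trans; ≤-reflexive; ≮⇒≥; +-suc; +-comm; +-monoʳ-≤; m≤m+n; n≤1+n)
open import Data.Fin as Fin using (Fin)
open import Data.Bool as Bool using (true)
open import Function using (_∘_; id; case_of_)
open import Data.Fin.Subset
  using (Subset; Nonempty; _∈_; _∉_; _⊆_; _∩_; ⊤; ∣_∣; _-_; _─_; _∪_; ⁅_⁆; ⊥; inside; outside)
open import Data.Fin.Subset.Properties
  using (_∈?_; _⊆?_; nonempty?; anySubset?; ∈⊤; ⊆⊤; ∉⊥; ⊆-refl; ⊆-antisym; p∩q⊆p; p∩q⊆q; x∈p∩q⁺; x∈p∪q⁺; x∈p∪q⁻;
         x∈⁅x⁆; x∈⁅y⁆⇒x≡y; x∈p∧x≢y⇒x∈p-y; p─q⊆p; ∣p∣≤n; ∣⊥∣≡0; ∣⁅x⁆∣≡1; x∈p⇒∣p-x∣<∣p∣; p⊂q⇒∣p∣<∣q∣)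
open import Data.Fin.Properties using (any?; all?)
open import Data.Vec using ([]; _∷_; here; there)
open import Data.List as List using (List; []; _∷_; _++_; [_]; length)
open import Data.List.Membership.Propositional using () renaming (_∈_ to _∈ₗ_; _∉_ to _∉ₗ_)
open import Data.List.Membership.Propositional.Properties using (∈-∃++; ∈-++⁺ʳ; ∈-allFin)
open import Data.List.Properties using (++-assoc; length-map; length-tabulate)
open import Data.List.Relation.Unary.Any as Any using (here; there)
open import Data.List.Relation.Unary.All as All using (All; []; _∷_)
open import Data.List.Relation.Unary.All.Properties using (++⁻ˡ) renaming (map⁺ to All-map⁺)
open import Data.List.Relation.Unary.AllPairs using (AllPairs; []; _∷_)
open import Data.List.Relation.Unary.Linked as Linked using (Linked; []; [-]; _∷_)
open import Data.List.Relation.Unary.Unique.Propositional using (Unique)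
open import Data.List.Relation.Unary.Unique.Propositional.Properties using (Unique[x∷xs]⇒x∉xs)
open import Data.List.Relation.Binary.Permutation.Propositional
  using (_↭_; ↭-refl; ↭-sym; ↭-trans; ↭-prep; ↭-swap; ↭⇒↭ₛ)
open import Data.List.Relation.Binary.Permutation.Propositional.Properties
  using (shift; ++-comm; ∈-resp-↭; ↭-length)
import Data.List.Relation.Binary.Permutation.Setoid.Properties as ↭ₛ
open import Data.Product using (∃; ∃₂; _×_; _,_; proj₁; proj₂)
open import Data.Sum using (_⊎_; inj₁; inj₂; [_,_]′)
open import Effect.Monad using (RawMonad)
open import Function.Bundles using (Equivalence; mk⇔)
open import Level using (0ℓ)
open import Relation.Binary.PropositionalEquality using (_≡_; _≢_; ≢-sym; refl; sym; trans; cong; subst)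
open import Relation.Binary.PropositionalEquality.Properties using (setoid)
open import Relation.Nullary using (¬_; Dec; yes; no)
open import Relation.Nullary.Decidable
  using (¬¬-excluded-middle; decidable-stable; _×-dec_; _⊎-dec_; _→-dec_; ¬?)
open import Relation.Nullary.Negation using (¬¬-Monad; contradiction)
open import Relation.Nullary.Negation.Core using (DoubleNegation)

open RawMonad (¬¬-Monad {a = 0ℓ})

module _ {A : Set} (P : A → Set) (μ : A → ℕ) where

  IsMaximum : A → Set
  IsMaximum a = P a × (∀ b → P b → μ b ≤ μ a)

  ¬¬-maximum : ∀ {N} → (∀ {a} → P a → μ a ≤ N) → ∀ {a} → P a → DoubleNegation (∃ IsMaximum)
  ¬¬-maximum {N} bounded {a} pa = go N pa (m≤m+n N (μ a))
    where
    go : ∀ k {a} → P a → N ≤ k + μ a → DoubleNegation (∃ IsMaximum)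
    go zero {a} pa N≤μa = pure (a , pa , λ _ pb → ≤-trans (bounded pb) N≤μa)
    go (suc k) {a} pa N≤1+k+μa = do
      yes (b , pb , μa<μb) ← ¬¬-excluded-middle {A = ∃ λ b → P b × μ a < μ b}
        where no ¬larger → pure (a , pa , λ _ pb → ≮⇒≥ (λ μa<μb → ¬larger (_ , pb , μa<μb)))
      go k pb (≤-trans N≤1+k+μa (≤-trans (≤-reflexive (sym (+-suc k (μ a)))) (+-monoʳ-≤ k μa<μb)))

module _ {A : Set} {R : A → A → Set} where

  linked-++⁻ˡ : ∀ xs {ys} → Linked R (xs ++ ys) → Linked R xs
  linked-++⁻ˡ []           _         = []
  linked-++⁻ˡ (x ∷ [])     _         = [-]
  linked-++⁻ˡ (x ∷ y ∷ xs) (Rxy ∷ l) = Rxy ∷ linked-++⁻ˡ (y ∷ xs) l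

  linked-join : ∀ xs {y ys} → Linked R (xs ++ [ y ]) → Linked R (y ∷ ys) → Linked R (xs ++ y ∷ ys)
  linked-join []           _           l = l
  linked-join (x ∷ [])     (Rxy ∷ [-]) l = Rxy ∷ l
  linked-join (x ∷ x′ ∷ xs) (Rxx′ ∷ k) l = Rxx′ ∷ linked-join (x′ ∷ xs) k l

  linked-++⁻ʳ : ∀ xs {ys} → Linked R (xs ++ ys) → Linked R ys
  linked-++⁻ʳ []       l = l
  linked-++⁻ʳ (x ∷ xs) l = linked-++⁻ʳ xs (Linked.tail l)

  allPairs-++⁻ˡ : ∀ xs {ys} → AllPairs R (xs ++ ys) → AllPairs R xs
  allPairs-++⁻ˡ []       _          = []
  allPairs-++⁻ˡ (x ∷ xs) (px ∷ pxs) = ++⁻ˡ xs px ∷ allPairs-++⁻ˡ xs pxs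

module _ {A : Set} where

  ∉⇒≢ : ∀ {x y : A} {xs} → x ∉ₗ xs → y ∈ₗ xs → x ≢ y
  ∉⇒≢ x∉xs y∈xs refl = x∉xs y∈xs

  unique-resp-↭ : ∀ {xs ys : List A} → xs ↭ ys → Unique xs → Unique ys
  unique-resp-↭ xs↭ys = ↭ₛ.Unique-resp-↭ (setoid A) (↭⇒↭ₛ xs↭ys)

  unique-map⁺ : ∀ {B : Set} {P : A → Set} (f : A → B) → (∀ {a b} → P a → P b → f a ≡ f b → a ≡ b) →
                ∀ {xs} → All P xs → Unique xs → Unique (List.map f xs)
  unique-map⁺ f injective []         []               = []
  unique-map⁺ f injective (px ∷ pxs) (x≢xs ∷ unique) =
    All-map⁺ (All.zipWith (λ (x≢y , py) fx≡fy → x≢y (injective px py fx≡fy)) (x≢xs , pxs)) ∷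
    unique-map⁺ f injective pxs unique

  unique∧⊆⇒length≤ : ∀ {xs ys : List A} → Unique xs → (∀ {x} → x ∈ₗ xs → x ∈ₗ ys) → length xs ≤ length ys
  unique∧⊆⇒length≤ [] _ = z≤n
  unique∧⊆⇒length≤ {x ∷ xs} unique@(_ ∷ unique′) xs⊆ys with ∈-∃++ (xs⊆ys (here refl))
  ... | as , bs , refl =
    ≤-trans (s≤s (unique∧⊆⇒length≤ unique′ xs⊆as++bs)) (≤-reflexive (sym (↭-length (shift x as bs))))
    where
    xs⊆as++bs : ∀ {y} → y ∈ₗ xs → y ∈ₗ as ++ bs
    xs⊆as++bs y∈xs with ∈-resp-↭ (shift x as bs) (xs⊆ys (there y∈xs))
    ... | here y≡x    = contradiction (subst (_∈ₗ xs) y≡x y∈xs) (Unique[x∷xs]⇒x∉xs unique)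
    ... | there y∈as++bs = y∈as++bs

∣p∪q∣≤∣p∣+∣q∣ : ∀ {n} (p q : Subset n) → ∣ p ∪ q ∣ ≤ ∣ p ∣ + ∣ q ∣
∣p∪q∣≤∣p∣+∣q∣ []            []            = z≤n
∣p∪q∣≤∣p∣+∣q∣ (outside ∷ p) (outside ∷ q) = ∣p∪q∣≤∣p∣+∣q∣ p q
∣p∪q∣≤∣p∣+∣q∣ (outside ∷ p) (inside ∷ q)  =
  ≤-trans (s≤s (∣p∪q∣≤∣p∣+∣q∣ p q)) (≤-reflexive (sym (+-suc ∣ p ∣ ∣ q ∣)))
∣p∪q∣≤∣p∣+∣q∣ (inside ∷ p)  (outside ∷ q) = s≤s (∣p∪q∣≤∣p∣+∣q∣ p q)
∣p∪q∣≤∣p∣+∣q∣ (inside ∷ p)  (inside ∷ q)  = s≤s (≤-trans (∣p∪q∣≤∣p∣+∣q∣ p q) (+-monoʳ-≤ ∣ p ∣ (n≤1+n ∣ q ∣)))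

x∈p─q⇒x∉q : ∀ {n} {x : Fin n} (p q : Subset n) → x ∈ p ─ q → x ∉ q
x∈p─q⇒x∉q (inside ∷ p)  (inside ∷ q) () here
x∈p─q⇒x∉q (outside ∷ p) (inside ∷ q) () here
x∈p─q⇒x∉q (_ ∷ p)       (_ ∷ q)      (there x∈p─q) (there x∈q) = x∈p─q⇒x∉q p q x∈p─q x∈q

module _ {n : ℕ} where

  ∣p∪⁅x⁆∣≤1+∣p∣ : ∀ (p : Subset n) x → ∣ p ∪ ⁅ x ⁆ ∣ ≤ suc ∣ p ∣
  ∣p∪⁅x⁆∣≤1+∣p∣ p x = ≤-trans (∣p∪q∣≤∣p∣+∣q∣ p ⁅ x ⁆)
    (≤-reflexive (trans (cong (∣ p ∣ +_) (∣⁅x⁆∣≡1 x)) (+-comm ∣ p ∣ 1)))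

  x∈p-y⇒x≢y : ∀ {x y : Fin n} {p} → x ∈ p - y → x ≢ y
  x∈p-y⇒x≢y {x} {p = p} x∈p-x refl = x∈p─q⇒x∉q p ⁅ x ⁆ x∈p-x (x∈⁅x⁆ x)

  x∉p-x : ∀ {x : Fin n} {p} → x ∉ p - x
  x∉p-x x∈p-x = x∈p-y⇒x≢y x∈p-x refl

  x∈p-y⇒x∈p : ∀ {x y : Fin n} {p} → x ∈ p - y → x ∈ p
  x∈p-y⇒x∈p {y = y} {p} = p─q⊆p p ⁅ y ⁆

  ⊈⇒∃∉ : ∀ {p q : Subset n} → ¬ (p ⊆ q) → ∃ λ x → x ∈ p × x ∉ q
  ⊈⇒∃∉ {p} {q} p⊈q with any? (λ x → x ∈? p ×-dec ¬? (x ∈? q))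
  ... | yes witness = witness
  ... | no  none    = contradiction (λ {x} → p⊆q {x}) p⊈q
    where
    p⊆q : p ⊆ q
    p⊆q {x} x∈p with x ∈? q
    ... | yes x∈q = x∈q
    ... | no  x∉q = contradiction (x , x∈p , x∉q) none

  x∈p∪⁅y⁆⁻ : ∀ {x y : Fin n} {p} → x ∈ p ∪ ⁅ y ⁆ → x ∈ p ⊎ x ≡ y
  x∈p∪⁅y⁆⁻ {y = y} {p} x∈ with x∈p∪q⁻ p ⁅ y ⁆ x∈
  ... | inj₁ x∈p   = inj₁ x∈p
  ... | inj₂ x∈⁅y⁆ = inj₂ (x∈⁅y⁆⇒x≡y y x∈⁅y⁆)

  y∈p∪⁅y⁆ : ∀ {p : Subset n} y → y ∈ p ∪ ⁅ y ⁆
  y∈p∪⁅y⁆ y = x∈p∪q⁺ (inj₂ (x∈⁅x⁆ y))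

  p⊆p∪⁅y⁆ : ∀ {p : Subset n} {y} → p ⊆ p ∪ ⁅ y ⁆
  p⊆p∪⁅y⁆ x∈p = x∈p∪q⁺ (inj₁ x∈p)

  p∪⁅y⁆⊆q : ∀ {p q : Subset n} {y} → p ⊆ q → y ∈ q → p ∪ ⁅ y ⁆ ⊆ q
  p∪⁅y⁆⊆q p⊆q y∈q x∈ = [ p⊆q , (λ { refl → y∈q }) ]′ (x∈p∪⁅y⁆⁻ x∈)

  x∈p∧x∉p-y⇒x≡y : ∀ {x y : Fin n} {p} → x ∈ p → x ∉ p - y → x ≡ y
  x∈p∧x∉p-y⇒x≡y {x} {y} x∈p x∉p-y with x Fin.≟ y
  ... | yes x≡y = x≡y
  ... | no  x≢y = contradiction (x∈p∧x≢y⇒x∈p-y x∈p x≢y) x∉p-y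

  fromList : List (Fin n) → Subset n
  fromList []       = ⊥
  fromList (x ∷ xs) = ⁅ x ⁆ ∪ fromList xs

  ∈-fromList⁺ : ∀ {x} xs → x ∈ₗ xs → x ∈ fromList xs
  ∈-fromList⁺ (y ∷ xs) (here refl)  = x∈p∪q⁺ (inj₁ (x∈⁅x⁆ y))
  ∈-fromList⁺ (y ∷ xs) (there x∈xs) = x∈p∪q⁺ (inj₂ (∈-fromList⁺ xs x∈xs))

  ∈-fromList⁻ : ∀ {x} xs → x ∈ fromList xs → x ∈ₗ xs
  ∈-fromList⁻ []       x∈⊥ = contradiction x∈⊥ ∉⊥
  ∈-fromList⁻ (y ∷ xs) x∈  with x∈p∪q⁻ ⁅ y ⁆ (fromList xs) x∈
  ... | inj₁ x∈⁅y⁆ = here (x∈⁅y⁆⇒x≡y y x∈⁅y⁆)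
  ... | inj₂ x∈xs  = there (∈-fromList⁻ xs x∈xs)

module _ {n : ℕ} (G : Graph n) where
  open Graph G using (adj) renaming (sym to adj-sym; irrefl to adj-irrefl)

  Adj-sym : ∀ {u v} → Adj G u v → Adj G v u
  Adj-sym {u} {v} u~v = trans (adj-sym v u) u~v

  Adj⇒≢ : ∀ {u v} → Adj G u v → u ≢ v
  Adj⇒≢ {u} u~u refl with trans (sym (adj-irrefl u)) u~u
  ... | ()

  Adj? : ∀ u v → Dec (Adj G u v)
  Adj? u v = adj u v Bool.≟ true

  ClosedAdj? : ∀ u v → Dec (ClosedAdj G u v)
  ClosedAdj? u v = (u Fin.≟ v) ⊎-dec Adj? u v

  ClosedAdj-sym : ∀ {u v} → ClosedAdj G u v → ClosedAdj G v u
  ClosedAdj-sym (inj₁ u≡v) = inj₁ (sym u≡v)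
  ClosedAdj-sym (inj₂ u~v) = inj₂ (Adj-sym u~v)

  path-snoc : ∀ {S u v w} → PathIn G S u v → Adj G v w → w ∈ S → PathIn G S u w
  path-snoc (here v∈S)       v~w w∈S = step v∈S v~w (here w∈S)
  path-snoc (step u∈S u~u′ p) v~w w∈S = step u∈S u~u′ (path-snoc p v~w w∈S)

  path-sym : ∀ {S u v} → PathIn G S u v → PathIn G S v u
  path-sym (here u∈S)        = here u∈S
  path-sym (step u∈S u~u′ p) = path-snoc (path-sym p) (Adj-sym u~u′) u∈S

  path-trans : ∀ {S u v w} → PathIn G S u v → PathIn G S v w → PathIn G S u w
  path-trans (here _)          q = q
  path-trans (step u∈S u~u′ p) q = step u∈S u~u′ (path-trans p q)

  linked⇒path : ∀ {S h L x} → Linked (Adj G) (h ∷ L) → All (_∈ S) (h ∷ L) → x ∈ₗ h ∷ L → PathIn G S h x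
  linked⇒path _         (h∈S ∷ _)   (here refl)  = here h∈S
  linked⇒path (h~h′ ∷ l) (h∈S ∷ L⊆S) (there x∈L) = step h∈S h~h′ (linked⇒path l L⊆S x∈L)

  linked⇒connected : ∀ {S L} → Linked (Adj G) L → All (_∈ S) L → (∀ {x} → x ∈ S → x ∈ₗ L) → ConnectedIn G S
  linked⇒connected {L = []}    _ _    S⊆L u v u∈S _ = contradiction (S⊆L u∈S) λ ()
  linked⇒connected {L = _ ∷ _} l L⊆S S⊆L u v u∈S v∈S =
    path-trans (path-sym (linked⇒path l L⊆S (S⊆L u∈S))) (linked⇒path l L⊆S (S⊆L v∈S))

  -- Cycles of a block graph induce cliques

  -- A cycle is a duplicate-free list h ∷ M whose closed walk h ∷ M ++ [ h ] follows edges.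
  cycle-rotation : ∀ {h M w} → Linked (Adj G) (h ∷ M ++ [ h ]) → w ∈ₗ h ∷ M →
                   ∃ λ R → Linked (Adj G) R × (h ∷ M ↭ w ∷ R)
  cycle-rotation {h} {M} walk (here refl) = M , Linked.tail (linked-++⁻ˡ (h ∷ M) walk) , ↭-refl
  cycle-rotation {h} walk (there w∈M) with ∈-∃++ w∈M
  ... | A , B , refl =
    B ++ h ∷ A ,
    linked-join B (Linked.tail (linked-++⁻ʳ (h ∷ A) walk′)) (linked-++⁻ˡ (h ∷ A) walk′) ,
    ↭-trans (shift _ (h ∷ A) B) (↭-prep _ (++-comm (h ∷ A) B))
    where
    walk′ : Linked (Adj G) ((h ∷ A) ++ _ ∷ B ++ [ h ])
    walk′ = subst (Linked (Adj G)) (cong (h ∷_) (++-assoc A (_ ∷ B) [ h ])) walk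

  cycle-biconnected : ∀ {h M} → Linked (Adj G) (h ∷ M ++ [ h ]) → Unique (h ∷ M) →
                      Biconnected G (fromList (h ∷ M))
  cycle-biconnected {h} {M} walk unique =
    linked⇒connected (linked-++⁻ˡ C walk) (All.tabulate (∈-fromList⁺ C)) (∈-fromList⁻ C) ,
    λ w w∈C → connected-without (∈-fromList⁻ C w∈C)
    where
    C = h ∷ M
    connected-without : ∀ {w} → w ∈ₗ C → ConnectedIn G (Without G (fromList C) w)
    connected-without {w} w∈C with cycle-rotation walk w∈C
    ... | R , linkedR , C↭w∷R = linked⇒connected linkedR (All.tabulate R⊆) ⊆R
      where
      w∉R : w ∉ₗ R
      w∉R = Unique[x∷xs]⇒x∉xs (unique-resp-↭ C↭w∷R unique)
      R⊆ : ∀ {x} → x ∈ₗ R → x ∈ fromList C - w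
      R⊆ x∈R = x∈p∧x≢y⇒x∈p-y (∈-fromList⁺ C (∈-resp-↭ (↭-sym C↭w∷R) (there x∈R))) (≢-sym (∉⇒≢ w∉R x∈R))
      ⊆R : ∀ {x} → x ∈ fromList C - w → x ∈ₗ R
      ⊆R x∈C-w with ∈-resp-↭ C↭w∷R (∈-fromList⁻ C (x∈p-y⇒x∈p x∈C-w))
      ... | here x≡w  = contradiction x≡w (x∈p-y⇒x≢y x∈C-w)
      ... | there x∈R = x∈R

  ¬¬-block⊇ : ∀ {T} → Biconnected G T → Nonempty T → DoubleNegation (∃ λ B → IsBlock G B × T ⊆ B)
  ¬¬-block⊇ {T} biconnectedT (v , v∈T) =
    block <$> ¬¬-maximum Extends ∣_∣ (λ {B} _ → ∣p∣≤n B) (⊆-refl , biconnectedT)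
    where
    Extends : Subset n → Set
    Extends B = T ⊆ B × Biconnected G B
    block : ∃ (IsMaximum Extends ∣_∣) → ∃ λ B → IsBlock G B × T ⊆ B
    block (B , (T⊆B , biconnectedB) , largest) = B , ((v , T⊆B v∈T) , biconnectedB , maximal) , T⊆B
      where
      maximal : ∀ B′ → B ⊆ B′ → Biconnected G B′ → B′ ⊆ B
      maximal B′ B⊆B′ biconnectedB′ with B′ ⊆? B
      ... | yes B′⊆B = B′⊆B
      ... | no  B′⊈B with ⊈⇒∃∉ B′⊈B
      ...   | x , x∈B′ , x∉B = contradiction (largest B′ (B⊆B′ ∘ T⊆B , biconnectedB′))
                                             (<⇒≱ (p⊂q⇒∣p∣<∣q∣ (B⊆B′ , x , x∈B′ , x∉B)))

  cycle-clique : IsBlockGraph G → ∀ {h M} → Linked (Adj G) (h ∷ M ++ [ h ]) → Unique (h ∷ M) →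
                 IsClique G (fromList (h ∷ M))
  cycle-clique blockGraph {h} {M} walk unique u v u∈C v∈C u≢v = decidable-stable (Adj? u v) do
    B , isBlock , C⊆B ← ¬¬-block⊇ (cycle-biconnected walk unique) (h , ∈-fromList⁺ (h ∷ M) (here refl))
    pure (blockGraph B isBlock u v (C⊆B u∈C) (C⊆B v∈C) u≢v)

  chord-clique : IsBlockGraph G → ∀ {a} X {y B} → Linked (Adj G) (a ∷ X ++ y ∷ B) → Unique (a ∷ X ++ y ∷ B) →
                 Adj G y a → ∀ {u v} → u ∈ₗ a ∷ X ++ [ y ] → v ∈ₗ a ∷ X ++ [ y ] → u ≢ v → Adj G u v
  chord-clique blockGraph {a} X {y} {B} path unique y~a u∈C v∈C =
    cycle-clique blockGraph walk (allPairs-++⁻ˡ (a ∷ X ++ [ y ]) (subst Unique split unique)) _ _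
      (∈-fromList⁺ _ u∈C) (∈-fromList⁺ _ v∈C)
    where
    split : a ∷ X ++ y ∷ B ≡ (a ∷ X ++ [ y ]) ++ B
    split = cong (a ∷_) (sym (++-assoc X [ y ] B))
    walk : Linked (Adj G) (a ∷ (X ++ [ y ]) ++ [ a ])
    walk = subst (Linked (Adj G)) (cong (a ∷_) (sym (++-assoc X [ y ] [ a ])))
             (linked-join (a ∷ X) (linked-++⁻ˡ (a ∷ X ++ [ y ]) (subst (Linked (Adj G)) split path))
                          (y~a ∷ [-]))

  -- Separating vertices and closed twins

  Separates : Fin n → Fin n → Fin n → Set
  Separates w u v = (ClosedAdj G u w × ¬ ClosedAdj G v w) ⊎ (¬ ClosedAdj G u w × ClosedAdj G v w)

  SeparatedIn : Subset n → Subset n → Set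
  SeparatedIn S C = ∀ u v → u ∈ S → v ∈ S → u ≢ v → ∃ λ w → w ∈ C × Separates w u v

  TwinFreeIn : Subset n → Set
  TwinFreeIn S = SeparatedIn S S

  Inseparable : Subset n → Fin n → Fin n → Set
  Inseparable S u v = ¬ ∃ λ w → w ∈ S × Separates w u v

  separates-sym : ∀ {w u v} → Separates w u v → Separates w v u
  separates-sym (inj₁ (u∼w , v≁w)) = inj₂ (v≁w , u∼w)
  separates-sym (inj₂ (u≁w , v∼w)) = inj₁ (v∼w , u≁w)

  separator? : ∀ S u v → Dec (∃ λ w → w ∈ S × Separates w u v)
  separator? S u v = any? λ w → w ∈? S ×-dec
    ((ClosedAdj? u w ×-dec ¬? (ClosedAdj? v w)) ⊎-dec (¬? (ClosedAdj? u w) ×-dec ClosedAdj? v w))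

  inseparable⇒closedAdj : ∀ {S u v w} → Inseparable S u v → w ∈ S → ClosedAdj G u w → ClosedAdj G v w
  inseparable⇒closedAdj {v = v} {w} inseparable w∈S u∼w with ClosedAdj? v w
  ... | yes v∼w = v∼w
  ... | no  v≁w = contradiction (w , w∈S , inj₁ (u∼w , v≁w)) inseparable

  inseparable-sym : ∀ {S u v} → Inseparable S u v → Inseparable S v u
  inseparable-sym inseparable (w , w∈S , separates) = inseparable (w , w∈S , separates-sym separates)

  closed-twins-inseparable : ∀ {S a b} → (∀ {w} → w ∈ S → ClosedAdj G a w → ClosedAdj G b w) →
                             (∀ {w} → w ∈ S → ClosedAdj G b w → ClosedAdj G a w) →
                             Inseparable S a b
  closed-twins-inseparable a⇒b b⇒a (w , w∈S , inj₁ (a∼w , b≁w)) = b≁w (a⇒b w∈S a∼w)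
  closed-twins-inseparable a⇒b b⇒a (w , w∈S , inj₂ (a≁w , b∼w)) = a≁w (b⇒a w∈S b∼w)

  ¬twinFree⇒¬¬twins : ∀ {S} → ¬ TwinFreeIn S →
                       DoubleNegation (∃₂ λ u v → u ∈ S × v ∈ S × u ≢ v × Inseparable S u v)
  ¬twinFree⇒¬¬twins {S} ¬twinFree noTwins = ¬twinFree λ u v u∈S v∈S u≢v →
    decidable-stable (separator? S u v) λ inseparable → noTwins (u , v , u∈S , v∈S , u≢v , inseparable)

  -- A longest path starts at a vertex of degree at most one

  IsolatedIn : Subset n → Fin n → Set
  IsolatedIn S s = ∀ w → w ∈ S → ¬ Adj G s w

  PendantIn : Subset n → Fin n → Fin n → Set
  PendantIn S s x = x ∈ S × Adj G s x × (∀ w → w ∈ S → Adj G s w → w ≡ x)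

  IsPathIn : Subset n → List (Fin n) → Set
  IsPathIn S P = Linked (Adj G) P × Unique P × All (_∈ S) P

  LongestPathIn : Subset n → List (Fin n) → Set
  LongestPathIn S = IsMaximum (IsPathIn S) length

  module LongestPaths (blockGraph : IsBlockGraph G) {S : Subset n} where

    longest-neighbour∈ : ∀ {a P} → LongestPathIn S (a ∷ P) → ∀ {w} → w ∈ S → Adj G w a → w ∈ₗ a ∷ P
    longest-neighbour∈ {a} {P} ((linked , unique , P⊆S) , longest) {w} w∈S w~a
      with Any.any? (w Fin.≟_) (a ∷ P)
    ... | yes w∈P = w∈P
    ... | no  w∉P = contradiction
      (longest (w ∷ a ∷ P) (w~a ∷ linked , All.tabulate (∉⇒≢ w∉P) ∷ unique , w∈S ∷ P⊆S)) (1+n≰n {length (a ∷ P)})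

    longest-second-closedAdj : ∀ {a b R} → LongestPathIn S (a ∷ b ∷ R) →
                               ∀ {w} → w ∈ S → ClosedAdj G a w → ClosedAdj G b w
    longest-second-closedAdj ((a~b ∷ _ , _) , _) _ (inj₁ refl) = inj₂ (Adj-sym a~b)
    longest-second-closedAdj lp@((linked , unique@(_ ∷ b∉R ∷ _) , _) , _) w∈S (inj₂ a~w)
      with longest-neighbour∈ lp w∈S (Adj-sym a~w)
    ... | here refl         = contradiction refl (Adj⇒≢ a~w)
    ... | there (here refl) = inj₁ refl
    ... | there (there w∈R) with ∈-∃++ w∈R
    ...   | X , B , refl = inj₂ (chord-clique blockGraph (_ ∷ X) linked unique (Adj-sym a~w)
                                   (there (here refl)) (there (there (∈-++⁺ʳ X (here refl))))
                                   (All.lookup b∉R w∈R))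

    longest-swap : ∀ {a b c R} → LongestPathIn S (a ∷ b ∷ c ∷ R) → Adj G a c → LongestPathIn S (b ∷ a ∷ c ∷ R)
    longest-swap {a} {b} ((a~b ∷ _ ∷ linked , unique , a∈S ∷ b∈S ∷ R⊆S) , longest) a~c =
      (Adj-sym a~b ∷ a~c ∷ linked , unique-resp-↭ (↭-swap a b ↭-refl) unique , b∈S ∷ a∈S ∷ R⊆S) , longest

    -- A chord a ~ w closes a cycle through a, b and the third vertex c, so a ~ c; then b ∷ a ∷ c ∷ …
    -- is also a longest path, and longest-second-closedAdj on both paths makes a and b closed twins.
    longest-chord-inseparable : ∀ {a b R w} → LongestPathIn S (a ∷ b ∷ R) → w ∈ₗ R → Adj G a w →
                                Inseparable S a b
    longest-chord-inseparable lp (here refl) a~c = closed-twins-inseparable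
      (longest-second-closedAdj lp) (longest-second-closedAdj (longest-swap lp a~c))
    longest-chord-inseparable lp@((linked , unique@(a∉R ∷ _) , _) , _) (there w∈R) a~w with ∈-∃++ w∈R
    ... | X , B , refl = longest-chord-inseparable lp (here refl)
      (chord-clique blockGraph (_ ∷ _ ∷ X) linked unique (Adj-sym a~w)
         (here refl) (there (there (here refl))) (All.lookup a∉R (there (here refl))))

    longest-head-pendant : TwinFreeIn S → ∀ {a b R} → LongestPathIn S (a ∷ b ∷ R) →
                           ∀ w → w ∈ S → Adj G a w → w ≡ b
    longest-head-pendant twinFree lp@((a~b ∷ _ , _ , a∈S ∷ b∈S ∷ _) , _) w w∈S a~w
      with longest-neighbour∈ lp w∈S (Adj-sym a~w)
    ... | here refl          = contradiction refl (Adj⇒≢ a~w)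
    ... | there (here w≡b)   = w≡b
    ... | there (there w∈R)  =
      contradiction (twinFree _ _ a∈S b∈S (Adj⇒≢ a~b)) (longest-chord-inseparable lp w∈R a~w)

    ¬¬-low-degree : TwinFreeIn S → Nonempty S →
                    DoubleNegation (∃ λ s → s ∈ S × (IsolatedIn S s ⊎ ∃ (PendantIn S s)))
    ¬¬-low-degree twinFree (v , v∈S) = low-degree <$> ¬¬-maximum (IsPathIn S) length bounded path-v
      where
      path-v : IsPathIn S [ v ]
      path-v = [-] , [] ∷ [] , v∈S ∷ []
      bounded : ∀ {P} → IsPathIn S P → length P ≤ n
      bounded (_ , unique , _) =
        ≤-trans (unique∧⊆⇒length≤ unique (λ {x} _ → ∈-allFin x)) (≤-reflexive (length-tabulate id))
      low-degree : ∃ (LongestPathIn S) → ∃ λ s → s ∈ S × (IsolatedIn S s ⊎ ∃ (PendantIn S s))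
      low-degree ([] , _ , longest) with longest [ v ] path-v
      ... | ()
      low-degree (a ∷ [] , lp@((_ , _ , a∈S ∷ []) , _)) = a , a∈S , inj₁ isolated
        where
        isolated : IsolatedIn S a
        isolated w w∈S a~w with longest-neighbour∈ lp w∈S (Adj-sym a~w)
        ... | here refl = Adj⇒≢ a~w refl
      low-degree (a ∷ b ∷ R , lp@((a~b ∷ _ , _ , a∈S ∷ b∈S ∷ _) , _)) =
        a , a∈S , inj₂ (b , b∈S , a~b , longest-head-pendant twinFree lp)

  -- Identifying codes and maximal cliques of induced subgraphs

  DominatedIn : Subset n → Subset n → Set
  DominatedIn S C = ∀ u → u ∈ S → ∃ λ w → w ∈ C × ClosedAdj G u w

  Identifies : Subset n → Subset n → Set
  Identifies S C = DominatedIn S C × SeparatedIn S C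

  IsIDCodeIn : Subset n → Subset n → Set
  IsIDCodeIn S C = C ⊆ S × Identifies S C

  isIDCodeIn? : ∀ S C → Dec (IsIDCodeIn S C)
  isIDCodeIn? S C = C ⊆? S
    ×-dec all? (λ u → u ∈? S →-dec any? λ w → w ∈? C ×-dec ClosedAdj? u w)
    ×-dec all? (λ u → all? λ v → u ∈? S →-dec v ∈? S →-dec ¬? (u Fin.≟ v) →-dec separator? C u v)

  identifies-insert : ∀ {S C′ C r} → C′ ⊆ C → Identifies (S - r) C′ →
                      (∃ λ w → w ∈ C × ClosedAdj G r w) →
                      (∀ v → v ∈ S - r → ∃ λ w → w ∈ C × Separates w r v) →
                      Identifies S C
  identifies-insert {r = r} C′⊆C (dominated′ , separated′) r-dominated r-separated = dominated , separated
    where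
    dominated : DominatedIn _ _
    dominated u u∈S with u Fin.≟ r
    ... | yes refl = r-dominated
    ... | no  u≢r with dominated′ u (x∈p∧x≢y⇒x∈p-y u∈S u≢r)
    ...   | w , w∈C′ , u∼w = w , C′⊆C w∈C′ , u∼w
    separated : SeparatedIn _ _
    separated u v u∈S v∈S u≢v with u Fin.≟ r | v Fin.≟ r
    ... | yes refl | yes refl = contradiction refl u≢v
    ... | yes refl | no  v≢r  = r-separated v (x∈p∧x≢y⇒x∈p-y v∈S v≢r)
    ... | no  u≢r  | yes refl with r-separated u (x∈p∧x≢y⇒x∈p-y u∈S u≢r)
    ...   | w , w∈C , separates = w , w∈C , separates-sym separates
    separated u v u∈S v∈S u≢v | no u≢r | no v≢r
      with separated′ u v (x∈p∧x≢y⇒x∈p-y u∈S u≢r) (x∈p∧x≢y⇒x∈p-y v∈S v≢r) u≢v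
    ...   | w , w∈C′ , separates = w , C′⊆C w∈C′ , separates

  MaximalCliqueIn : Subset n → Subset n → Set
  MaximalCliqueIn S T = T ⊆ S × Nonempty T × IsClique G T × (∀ T′ → T′ ⊆ S → IsClique G T′ → T ⊆ T′ → T′ ⊆ T)

  CompleteTo : Fin n → Subset n → Set
  CompleteTo z T = ∀ t → t ∈ T → Adj G z t

  pair-clique : ∀ {x y} → Adj G x y → IsClique G (⁅ x ⁆ ∪ ⁅ y ⁆)
  pair-clique {x} {y} x~y u v u∈ v∈ u≢v with x∈p∪⁅y⁆⁻ u∈ | x∈p∪⁅y⁆⁻ v∈
  ... | inj₁ u∈⁅x⁆ | inj₁ v∈⁅x⁆ = contradiction (trans (x∈⁅y⁆⇒x≡y x u∈⁅x⁆) (sym (x∈⁅y⁆⇒x≡y x v∈⁅x⁆))) u≢v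
  ... | inj₁ u∈⁅x⁆ | inj₂ refl  = subst (λ u → Adj G u v) (sym (x∈⁅y⁆⇒x≡y x u∈⁅x⁆)) x~y
  ... | inj₂ refl  | inj₁ v∈⁅x⁆ = subst (Adj G u) (sym (x∈⁅y⁆⇒x≡y x v∈⁅x⁆)) (Adj-sym x~y)
  ... | inj₂ refl  | inj₂ refl  = contradiction refl u≢v

  clique-∪⁅⁆ : ∀ {T x} → IsClique G T → CompleteTo x T → IsClique G (T ∪ ⁅ x ⁆)
  clique-∪⁅⁆ {T} {x} cliqueT complete u v u∈ v∈ u≢v with x∈p∪⁅y⁆⁻ u∈ | x∈p∪⁅y⁆⁻ v∈
  ... | inj₁ u∈T | inj₁ v∈T = cliqueT u v u∈T v∈T u≢v
  ... | inj₁ u∈T | inj₂ refl = Adj-sym (complete u u∈T)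
  ... | inj₂ refl | inj₁ v∈T = complete v v∈T
  ... | inj₂ refl | inj₂ refl = contradiction refl u≢v

  maximalClique-extend : ∀ {R S T U} → MaximalCliqueIn R T → T ⊆ U → U ⊆ S → IsClique G U →
                         (∀ z → z ∈ S → z ∉ R → CompleteTo z T → z ∈ U) → MaximalCliqueIn S U
  maximalClique-extend {R} {S} {T} {U} (T⊆R , (t , t∈T) , cliqueT , maximalT) T⊆U U⊆S cliqueU complete⇒∈U =
    U⊆S , (t , T⊆U t∈T) , cliqueU , maximal
    where
    maximal : ∀ T′ → T′ ⊆ S → IsClique G T′ → U ⊆ T′ → T′ ⊆ U
    maximal T′ T′⊆S cliqueT′ U⊆T′ {z} z∈T′ with z ∈? R
    ... | yes z∈R = T⊆U (maximalT (T′ ∩ R) (p∩q⊆q T′ R)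
      (λ u v u∈ v∈ → cliqueT′ u v (p∩q⊆p T′ R u∈) (p∩q⊆p T′ R v∈))
      (λ t∈T → x∈p∩q⁺ (U⊆T′ (T⊆U t∈T) , T⊆R t∈T)) (x∈p∩q⁺ (z∈T′ , z∈R)))
    ... | no  z∉R = complete⇒∈U z (T′⊆S z∈T′) z∉R λ t t∈T →
      cliqueT′ z t z∈T′ (U⊆T′ (T⊆U t∈T)) λ { refl → z∉R (T⊆R t∈T) }

  maximalClique-∌ : ∀ {S s T} → MaximalCliqueIn (S - s) T → s ∉ T
  maximalClique-∌ (T⊆S-s , _) = x∉p-x ∘ T⊆S-s

  CodeBoundedByCliquesIn : Subset n → Set
  CodeBoundedByCliquesIn S =
    ∃ λ C → IsIDCodeIn S C × ∃ λ Ts → Unique Ts × All (MaximalCliqueIn S) Ts × ∣ C ∣ ≤ length Ts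

  codeBounded-empty : ∀ {S} → ¬ Nonempty S → CodeBoundedByCliquesIn S
  codeBounded-empty empty =
    ⊥ , ((λ x∈⊥ → contradiction x∈⊥ ∉⊥) , (λ u u∈S → contradiction (u , u∈S) empty) ,
         (λ u _ u∈S → contradiction (u , u∈S) empty)) ,
    [] , [] , [] , ≤-reflexive (∣⊥∣≡0 n)

  codeBounded-insert : ∀ {S C′ c K Ts} → IsIDCodeIn S (C′ ∪ ⁅ c ⁆) → ∣ C′ ∣ ≤ length Ts →
                       All (MaximalCliqueIn S) (K ∷ Ts) → Unique Ts → All (K ≢_) Ts → CodeBoundedByCliquesIn S
  codeBounded-insert {C′ = C′} {c} code ∣C′∣≤ maximal unique K∉Ts =
    C′ ∪ ⁅ c ⁆ , code , _ , K∉Ts ∷ unique , maximal , ≤-trans (∣p∪⁅x⁆∣≤1+∣p∣ C′ c) (s≤s ∣C′∣≤)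

  ∈∧All∉⇒All≢ : ∀ {s : Fin n} {K Ts} → s ∈ K → All (s ∉_) Ts → All (K ≢_) Ts
  ∈∧All∉⇒All≢ s∈K = All.map λ s∉T K≡T → s∉T (subst (_ ∈_) K≡T s∈K)

  module Isolated {S s} (s∈S : s ∈ S) (isolated : IsolatedIn S s) where

    ¬closedAdj-s : ∀ {v} → v ∈ S - s → ¬ ClosedAdj G v s
    ¬closedAdj-s v∈S-s (inj₁ refl) = x∉p-x v∈S-s
    ¬closedAdj-s v∈S-s (inj₂ v~s)  = isolated _ (x∈p-y⇒x∈p v∈S-s) (Adj-sym v~s)

    twinFree-without : TwinFreeIn S → TwinFreeIn (S - s)
    twinFree-without twinFree u v u∈ v∈ u≢v with twinFree u v (x∈p-y⇒x∈p u∈) (x∈p-y⇒x∈p v∈) u≢v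
    ... | w , w∈S , separates with w Fin.≟ s
    ...   | no  w≢s = w , x∈p∧x≢y⇒x∈p-y w∈S w≢s , separates
    ...   | yes refl with separates
    ...     | inj₁ (u∼s , _) = contradiction u∼s (¬closedAdj-s u∈)
    ...     | inj₂ (_ , v∼s) = contradiction v∼s (¬closedAdj-s v∈)

    singleton-maximal : MaximalCliqueIn S ⁅ s ⁆
    singleton-maximal =
      (λ z∈⁅s⁆ → subst (_∈ S) (sym (x∈⁅y⁆⇒x≡y s z∈⁅s⁆)) s∈S) , (s , x∈⁅x⁆ s) ,
      (λ u v u∈ v∈ u≢v → contradiction (trans (x∈⁅y⁆⇒x≡y s u∈) (sym (x∈⁅y⁆⇒x≡y s v∈))) u≢v) , maximal
      where
      maximal : ∀ T′ → T′ ⊆ S → IsClique G T′ → ⁅ s ⁆ ⊆ T′ → T′ ⊆ ⁅ s ⁆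
      maximal T′ T′⊆S cliqueT′ s∈T′ {z} z∈T′ with z Fin.≟ s
      ... | yes refl = x∈⁅x⁆ s
      ... | no  z≢s  = contradiction (cliqueT′ s z (s∈T′ (x∈⁅x⁆ s)) z∈T′ (≢-sym z≢s)) (isolated z (T′⊆S z∈T′))

    lift : ∀ {T} → MaximalCliqueIn (S - s) T → MaximalCliqueIn S T
    lift maximal@(T⊆ , (t , t∈T) , cliqueT , _) = maximalClique-extend maximal id (x∈p-y⇒x∈p ∘ T⊆) cliqueT
      λ z z∈S z∉S-s complete → contradiction (complete t t∈T)
        (subst (λ z → ¬ Adj G z t) (sym (x∈p∧x∉p-y⇒x≡y z∈S z∉S-s)) (isolated t (x∈p-y⇒x∈p (T⊆ t∈T))))

    codeBounded-isolated : CodeBoundedByCliquesIn (S - s) → CodeBoundedByCliquesIn S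
    codeBounded-isolated (C′ , code′@(C′⊆ , _) , Ts , unique , maximal , ∣C′∣≤) =
      codeBounded-insert code ∣C′∣≤ (singleton-maximal ∷ All.map lift maximal) unique
        (∈∧All∉⇒All≢ (x∈⁅x⁆ s) (All.map maximalClique-∌ maximal))
      where
      code : IsIDCodeIn S (C′ ∪ ⁅ s ⁆)
      code = p∪⁅y⁆⊆q (x∈p-y⇒x∈p ∘ C′⊆) s∈S , identifies-insert p⊆p∪⁅y⁆ (proj₂ code′)
        (s , y∈p∪⁅y⁆ s , inj₁ refl) λ v v∈ → s , y∈p∪⁅y⁆ s , inj₁ (inj₁ refl , ¬closedAdj-s v∈)

  module Pendant {S s x} (twinFree : TwinFreeIn S) (s∈S : s ∈ S) (pendant : PendantIn S s x) where

    x∈S : x ∈ S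
    x∈S = proj₁ pendant

    s~x : Adj G s x
    s~x = proj₁ (proj₂ pendant)

    onlyX : ∀ w → w ∈ S → Adj G s w → w ≡ x
    onlyX = proj₂ (proj₂ pendant)

    closedAdj-s : ∀ {w} → w ∈ S → ClosedAdj G s w → w ≡ s ⊎ w ≡ x
    closedAdj-s w∈S (inj₁ refl) = inj₁ refl
    closedAdj-s w∈S (inj₂ s~w)  = inj₂ (onlyX _ w∈S s~w)

    closedAdj-s⇒≡x : ∀ {w} → w ∈ S - s → ClosedAdj G s w → w ≡ x
    closedAdj-s⇒≡x w∈S-s s∼w with closedAdj-s (x∈p-y⇒x∈p w∈S-s) s∼w
    ... | inj₁ w≡s = contradiction w≡s (x∈p-y⇒x≢y w∈S-s)
    ... | inj₂ w≡x = w≡x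

    ¬closedAdj-s : ∀ {w} → w ∈ S - s → w ≢ x → ¬ ClosedAdj G s w
    ¬closedAdj-s w∈S-s w≢x = w≢x ∘ closedAdj-s⇒≡x w∈S-s

    x∈S-s : x ∈ S - s
    x∈S-s = x∈p∧x≢y⇒x∈p-y x∈S (≢-sym (Adj⇒≢ s~x))

    neighbour-of-x : ∃ λ y → y ∈ S - s × Adj G x y
    neighbour-of-x with twinFree s x s∈S x∈S (Adj⇒≢ s~x)
    ... | w , w∈S , inj₁ (s∼w , x≁w) with closedAdj-s w∈S s∼w
    ...   | inj₁ refl = contradiction (inj₂ (Adj-sym s~x)) x≁w
    ...   | inj₂ refl = contradiction (inj₁ refl) x≁w
    neighbour-of-x | w , w∈S , inj₂ (s≁w , inj₁ refl) = contradiction (inj₂ s~x) s≁w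
    neighbour-of-x | w , w∈S , inj₂ (s≁w , inj₂ x~w) =
      w , x∈p∧x≢y⇒x∈p-y w∈S (λ { refl → s≁w (inj₁ refl) }) , x~w

    pair-maximal : MaximalCliqueIn S (⁅ x ⁆ ∪ ⁅ s ⁆)
    pair-maximal = pair⊆S , (s , y∈p∪⁅y⁆ s) , pair-clique (Adj-sym s~x) , maximal
      where
      pair⊆S : ⁅ x ⁆ ∪ ⁅ s ⁆ ⊆ S
      pair⊆S z∈ with x∈p∪⁅y⁆⁻ z∈
      ... | inj₁ z∈⁅x⁆ = subst (_∈ S) (sym (x∈⁅y⁆⇒x≡y x z∈⁅x⁆)) x∈S
      ... | inj₂ refl  = s∈S
      maximal : ∀ T′ → T′ ⊆ S → IsClique G T′ → ⁅ x ⁆ ∪ ⁅ s ⁆ ⊆ T′ → T′ ⊆ ⁅ x ⁆ ∪ ⁅ s ⁆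
      maximal T′ T′⊆S cliqueT′ pair⊆T′ {z} z∈T′ with z Fin.≟ s
      ... | yes refl = y∈p∪⁅y⁆ s
      ... | no  z≢s with onlyX z (T′⊆S z∈T′) (cliqueT′ s z (pair⊆T′ (y∈p∪⁅y⁆ s)) z∈T′ (≢-sym z≢s))
      ...   | refl = p⊆p∪⁅y⁆ (x∈⁅x⁆ x)

    y : Fin n
    y = proj₁ neighbour-of-x

    y∈S-s : y ∈ S - s
    y∈S-s = proj₁ (proj₂ neighbour-of-x)

    x~y : Adj G x y
    x~y = proj₂ (proj₂ neighbour-of-x)

    s-not-complete : ∀ {T} → MaximalCliqueIn (S - s) T → ¬ CompleteTo s T
    s-not-complete {T} (T⊆S-s , (t , t∈T) , _ , maximal) complete = Adj⇒≢ x~y (sym (T⊆⁅x⁆ y∈T))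
      where
      T⊆⁅x⁆ : ∀ {z} → z ∈ T → z ≡ x
      T⊆⁅x⁆ {z} z∈T = onlyX z (x∈p-y⇒x∈p (T⊆S-s z∈T)) (complete z z∈T)
      pair⊆S-s : ⁅ x ⁆ ∪ ⁅ y ⁆ ⊆ S - s
      pair⊆S-s = p∪⁅y⁆⊆q (λ z∈⁅x⁆ → subst (_∈ S - s) (sym (x∈⁅y⁆⇒x≡y x z∈⁅x⁆)) x∈S-s) y∈S-s
      y∈T : y ∈ T
      y∈T = maximal (⁅ x ⁆ ∪ ⁅ y ⁆) pair⊆S-s (pair-clique x~y)
        (λ z∈T → p⊆p∪⁅y⁆ (subst (_∈ ⁅ x ⁆) (sym (T⊆⁅x⁆ z∈T)) (x∈⁅x⁆ x))) (y∈p∪⁅y⁆ y)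

    lift : ∀ {T} → MaximalCliqueIn (S - s) T → MaximalCliqueIn S T
    lift {T} maximal@(T⊆ , _ , cliqueT , _) = maximalClique-extend maximal id (x∈p-y⇒x∈p ∘ T⊆) cliqueT
      λ z z∈S z∉S-s complete →
        contradiction (subst (λ z → CompleteTo z T) (x∈p∧x∉p-y⇒x≡y z∈S z∉S-s) complete) (s-not-complete maximal)

    -- If x has a code neighbour w₀ ≢ x, it separates s from x; otherwise x is itself a code vertex
    -- and the neighbour y of x separates s from x.
    code-pendant : ∀ {C′} → IsIDCodeIn (S - s) C′ → ∃ λ c → IsIDCodeIn S (C′ ∪ ⁅ c ⁆)
    code-pendant {C′} (C′⊆ , identifies′@(dominated′ , separated′))
      with any? (λ w → w ∈? C′ ×-dec ¬? (w Fin.≟ x) ×-dec Adj? x w)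
    ... | yes (w₀ , w₀∈C′ , w₀≢x , x~w₀) =
      s , p∪⁅y⁆⊆q (x∈p-y⇒x∈p ∘ C′⊆) s∈S ,
      identifies-insert p⊆p∪⁅y⁆ identifies′ (s , y∈p∪⁅y⁆ s , inj₁ refl) separate
      where
      separate : ∀ v → v ∈ S - s → ∃ λ w → w ∈ C′ ∪ ⁅ s ⁆ × Separates w s v
      separate v v∈S-s with v Fin.≟ x
      ... | yes refl = w₀ , p⊆p∪⁅y⁆ w₀∈C′ , inj₂ (¬closedAdj-s (C′⊆ w₀∈C′) w₀≢x , inj₂ x~w₀)
      ... | no  v≢x  = s , y∈p∪⁅y⁆ s , inj₁ (inj₁ refl , ¬closedAdj-s v∈S-s v≢x ∘ ClosedAdj-sym)
    ... | no  none =
      y , p∪⁅y⁆⊆q (x∈p-y⇒x∈p ∘ C′⊆) (x∈p-y⇒x∈p y∈S-s) ,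
      identifies-insert p⊆p∪⁅y⁆ identifies′ (x , p⊆p∪⁅y⁆ x∈C′ , inj₂ s~x) separate
      where
      x∈C′ : x ∈ C′
      x∈C′ with dominated′ x x∈S-s
      ... | w , w∈C′ , inj₁ refl = w∈C′
      ... | w , w∈C′ , inj₂ x~w  = contradiction (w , w∈C′ , ≢-sym (Adj⇒≢ x~w) , x~w) none
      separate : ∀ v → v ∈ S - s → ∃ λ w → w ∈ C′ ∪ ⁅ y ⁆ × Separates w s v
      separate v v∈S-s with v Fin.≟ x
      ... | yes refl = y , y∈p∪⁅y⁆ y , inj₂ (¬closedAdj-s y∈S-s (≢-sym (Adj⇒≢ x~y)) , inj₂ x~y)
      ... | no  v≢x with separated′ v x v∈S-s x∈S-s v≢x
      ...   | w , w∈C′ , inj₁ (v∼w , x≁w) =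
        w , p⊆p∪⁅y⁆ w∈C′ , inj₂ (¬closedAdj-s (C′⊆ w∈C′) (λ { refl → x≁w (inj₁ refl) }) , v∼w)
      ...   | w , w∈C′ , inj₂ (v≁w , inj₁ refl) = x , p⊆p∪⁅y⁆ w∈C′ , inj₁ (inj₂ s~x , v≁w)
      ...   | w , w∈C′ , inj₂ (v≁w , inj₂ x~w)  = contradiction (w , w∈C′ , ≢-sym (Adj⇒≢ x~w) , x~w) none

    codeBounded-pendant : CodeBoundedByCliquesIn (S - s) → CodeBoundedByCliquesIn S
    codeBounded-pendant (C′ , code′ , Ts , unique , maximal , ∣C′∣≤) =
      codeBounded-insert (proj₂ (code-pendant code′)) ∣C′∣≤ (pair-maximal ∷ All.map lift maximal) unique
        (∈∧All∉⇒All≢ (y∈p∪⁅y⁆ s) (All.map maximalClique-∌ maximal))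

    twin-of-x : (∃₂ λ u v → u ∈ S - s × v ∈ S - s × u ≢ v × Inseparable (S - s) u v) →
                ∃ λ t → t ∈ S - s × t ≢ x × Inseparable (S - s) x t
    twin-of-x (u , v , u∈ , v∈ , u≢v , inseparable) with twinFree u v (x∈p-y⇒x∈p u∈) (x∈p-y⇒x∈p v∈) u≢v
    ... | w , w∈S , separates with w Fin.≟ s
    ...   | no  w≢s = contradiction (w , x∈p∧x≢y⇒x∈p-y w∈S w≢s , separates) inseparable
    ...   | yes refl with separates
    ...     | inj₁ (u∼s , _) with closedAdj-s⇒≡x u∈ (ClosedAdj-sym u∼s)
    ...       | refl = v , v∈ , ≢-sym u≢v , inseparable
    twin-of-x (u , v , u∈ , v∈ , u≢v , inseparable) | _ , _ , _ | yes refl | inj₂ (_ , v∼s)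
      with closedAdj-s⇒≡x v∈ (ClosedAdj-sym v∼s)
    ...       | refl = u , u∈ , u≢v , inseparable-sym inseparable

    -- Separations of G[S - s - x] that used x are taken over by its twin t.
    module Twin {t} (t∈S-s : t ∈ S - s) (t≢x : t ≢ x) (inseparable : Inseparable (S - s) x t) where

      S-s-x⊆S : S - s - x ⊆ S
      S-s-x⊆S = x∈p-y⇒x∈p ∘ x∈p-y⇒x∈p

      ¬closedAdj-s″ : ∀ {w} → w ∈ S - s - x → ¬ ClosedAdj G s w
      ¬closedAdj-s″ w∈ = ¬closedAdj-s (x∈p-y⇒x∈p w∈) (x∈p-y⇒x≢y w∈)

      t∈S-s-x : t ∈ S - s - x
      t∈S-s-x = x∈p∧x≢y⇒x∈p-y t∈S-s t≢x

      x⇒t : ∀ {w} → w ∈ S - s → ClosedAdj G w x → ClosedAdj G w t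
      x⇒t w∈ = ClosedAdj-sym ∘ inseparable⇒closedAdj inseparable w∈ ∘ ClosedAdj-sym

      t⇒x : ∀ {w} → w ∈ S - s → ClosedAdj G w t → ClosedAdj G w x
      t⇒x w∈ = ClosedAdj-sym ∘ inseparable⇒closedAdj (inseparable-sym inseparable) w∈ ∘ ClosedAdj-sym

      twinFree-without : TwinFreeIn (S - s - x)
      twinFree-without u v u∈ v∈ u≢v with twinFree u v (S-s-x⊆S u∈) (S-s-x⊆S v∈) u≢v
      ... | w , w∈S , separates with w Fin.≟ s | w Fin.≟ x
      ...   | yes refl | _ = contradiction separates [ (λ (u∼s , _) → ¬closedAdj-s″ u∈ (ClosedAdj-sym u∼s)) ,
                                                     (λ (_ , v∼s) → ¬closedAdj-s″ v∈ (ClosedAdj-sym v∼s)) ]′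
      ...   | no  _    | yes refl = t , t∈S-s-x , [
        (λ (u∼x , v≁x) → inj₁ (x⇒t (x∈p-y⇒x∈p u∈) u∼x , v≁x ∘ t⇒x (x∈p-y⇒x∈p v∈))) ,
        (λ (u≁x , v∼x) → inj₂ (u≁x ∘ t⇒x (x∈p-y⇒x∈p u∈) , x⇒t (x∈p-y⇒x∈p v∈) v∼x)) ]′ separates
      ...   | no  w≢s  | no  w≢x  = w , x∈p∧x≢y⇒x∈p-y (x∈p∧x≢y⇒x∈p-y w∈S w≢s) w≢x , separates

      code-twin : ∀ {C″} → IsIDCodeIn (S - s - x) C″ → IsIDCodeIn S (C″ ∪ ⁅ s ⁆)
      code-twin {C″} (C″⊆ , identifies″@(dominated″ , _)) =
        p∪⁅y⁆⊆q (S-s-x⊆S ∘ C″⊆) s∈S ,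
        identifies-insert id identifies-S-s (s , y∈p∪⁅y⁆ s , inj₁ refl) separate-s
        where
        identifies-S-s : Identifies (S - s) (C″ ∪ ⁅ s ⁆)
        identifies-S-s = identifies-insert p⊆p∪⁅y⁆ identifies″ (s , y∈p∪⁅y⁆ s , inj₂ (Adj-sym s~x))
          λ v v∈ → s , y∈p∪⁅y⁆ s , inj₁ (inj₂ (Adj-sym s~x) , ¬closedAdj-s″ v∈ ∘ ClosedAdj-sym)
        separate-s : ∀ v → v ∈ S - s → ∃ λ w → w ∈ C″ ∪ ⁅ s ⁆ × Separates w s v
        separate-s v v∈S-s with v Fin.≟ x
        ... | no  v≢x  = s , y∈p∪⁅y⁆ s , inj₁ (inj₁ refl , ¬closedAdj-s v∈S-s v≢x ∘ ClosedAdj-sym)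
        ... | yes refl with dominated″ t t∈S-s-x
        ...   | w , w∈C″ , t∼w = w , p⊆p∪⁅y⁆ w∈C″ ,
          inj₂ (¬closedAdj-s″ (C″⊆ w∈C″) , ClosedAdj-sym (t⇒x (x∈p-y⇒x∈p (C″⊆ w∈C″)) (ClosedAdj-sym t∼w)))

      complete? : ∀ z T → Dec (CompleteTo z T)
      complete? z T = all? λ t → t ∈? T →-dec Adj? z t

      withX : Subset n → Subset n
      withX T with complete? x T
      ... | yes _ = T ∪ ⁅ x ⁆
      ... | no  _ = T

      ∈-withX⁺ : ∀ {T z} → z ∈ T → z ∈ withX T
      ∈-withX⁺ {T} z∈T with complete? x T
      ... | yes _ = p⊆p∪⁅y⁆ z∈T
      ... | no  _ = z∈T

      ∈-withX⁻ : ∀ {T z} → z ∈ withX T → z ∈ T ⊎ z ≡ x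
      ∈-withX⁻ {T} z∈ with complete? x T
      ... | yes _ = x∈p∪⁅y⁆⁻ z∈
      ... | no  _ = inj₁ z∈

      withX-injective : ∀ {A B} → MaximalCliqueIn (S - s - x) A → MaximalCliqueIn (S - s - x) B →
                        withX A ≡ withX B → A ≡ B
      withX-injective (A⊆ , _) (B⊆ , _) withA≡withB =
        ⊆-antisym (⊆-from A⊆ withA≡withB) (⊆-from B⊆ (sym withA≡withB))
        where
        ⊆-from : ∀ {A B} → A ⊆ S - s - x → withX A ≡ withX B → A ⊆ B
        ⊆-from A⊆ withA≡withB z∈A with ∈-withX⁻ (subst (_ ∈_) withA≡withB (∈-withX⁺ z∈A))
        ... | inj₁ z∈B = z∈B
        ... | inj₂ refl = contradiction refl (x∈p-y⇒x≢y (A⊆ z∈A))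

      s∉withX : ∀ {T} → MaximalCliqueIn (S - s - x) T → s ∉ withX T
      s∉withX (T⊆ , _) s∈ with ∈-withX⁻ s∈
      ... | inj₁ s∈T = x∉p-x (x∈p-y⇒x∈p (T⊆ s∈T))
      ... | inj₂ s≡x = Adj⇒≢ s~x s≡x

      outside-¬complete : ∀ {T z} → MaximalCliqueIn (S - s - x) T →
                          z ∈ S → z ∉ S - s - x → z ≢ x → ¬ CompleteTo z T
      outside-¬complete (T⊆ , (t₀ , t₀∈T) , _) z∈S z∉ z≢x complete
        with x∈p∧x∉p-y⇒x≡y z∈S (λ z∈S-s → z∉ (x∈p∧x≢y⇒x∈p-y z∈S-s z≢x))
      ... | refl = x∈p-y⇒x≢y (T⊆ t₀∈T) (onlyX t₀ (S-s-x⊆S (T⊆ t₀∈T)) (complete t₀ t₀∈T))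

      withX-maximal : ∀ {T} → MaximalCliqueIn (S - s - x) T → MaximalCliqueIn S (withX T)
      withX-maximal {T} maximal@(T⊆ , _ , cliqueT , _) with complete? x T
      ... | yes x-complete =
        maximalClique-extend maximal p⊆p∪⁅y⁆ (p∪⁅y⁆⊆q (S-s-x⊆S ∘ T⊆) x∈S) (clique-∪⁅⁆ cliqueT x-complete)
          λ z z∈S z∉ complete → case z Fin.≟ x of λ where
            (yes refl) → y∈p∪⁅y⁆ x
            (no z≢x)   → contradiction complete (outside-¬complete maximal z∈S z∉ z≢x)
      ... | no  x-incomplete =
        maximalClique-extend maximal id (S-s-x⊆S ∘ T⊆) cliqueT
          λ z z∈S z∉ complete → case z Fin.≟ x of λ where
            (yes refl) → contradiction complete x-incomplete
            (no z≢x)   → contradiction complete (outside-¬complete maximal z∈S z∉ z≢x)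

      codeBounded-twin : CodeBoundedByCliquesIn (S - s - x) → CodeBoundedByCliquesIn S
      codeBounded-twin (C″ , code″ , Ts , unique , maximal , ∣C″∣≤) =
        codeBounded-insert (code-twin code″) (≤-trans ∣C″∣≤ (≤-reflexive (sym (length-map withX Ts))))
          (pair-maximal ∷ All-map⁺ (All.map withX-maximal maximal))
          (unique-map⁺ withX withX-injective maximal unique)
          (∈∧All∉⇒All≢ (y∈p∪⁅y⁆ s) (All-map⁺ (All.map s∉withX maximal)))

  ¬¬-codeBoundedByCliques : IsBlockGraph G → ∀ k {S} → ∣ S ∣ ≤ k → TwinFreeIn S →
                            DoubleNegation (CodeBoundedByCliquesIn S)
  ¬¬-codeBoundedByCliques _ zero ∣S∣≤0 _ =
    pure (codeBounded-empty λ (v , v∈S) → n≮0 (<-≤-trans (x∈p⇒∣p-x∣<∣p∣ v∈S) ∣S∣≤0))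
  ¬¬-codeBoundedByCliques blockGraph (suc k) {S} ∣S∣≤1+k twinFree with nonempty? S
  ... | no  empty    = pure (codeBounded-empty empty)
  ... | yes nonempty = LongestPaths.¬¬-low-degree blockGraph twinFree nonempty >>= remove
    where
    recurse : ∀ {R} → R ⊆ S → (∃ λ s → s ∈ S × s ∉ R) → TwinFreeIn R → DoubleNegation (CodeBoundedByCliquesIn R)
    recurse R⊆S (s , s∈S , s∉R) = ¬¬-codeBoundedByCliques blockGraph k
      (≤-pred (≤-trans (p⊂q⇒∣p∣<∣q∣ (R⊆S , s , s∈S , s∉R)) ∣S∣≤1+k))
    remove : (∃ λ s → s ∈ S × (IsolatedIn S s ⊎ ∃ (PendantIn S s))) → DoubleNegation (CodeBoundedByCliquesIn S)
    remove (s , s∈S , inj₁ isolated) =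
      codeBounded-isolated <$> recurse x∈p-y⇒x∈p (s , s∈S , x∉p-x) (twinFree-without twinFree)
      where open Isolated s∈S isolated
    remove (s , s∈S , inj₂ (x , pendant)) = do
      yes twinFree′ ← ¬¬-excluded-middle {A = TwinFreeIn (S - s)}
        where no ¬twinFree′ → do
          t , t∈S-s , t≢x , inseparable ← twin-of-x <$> ¬twinFree⇒¬¬twins ¬twinFree′
          let open Twin t∈S-s t≢x inseparable
          codeBounded-twin <$> recurse S-s-x⊆S (s , s∈S , x∉p-x ∘ x∈p-y⇒x∈p) twinFree-without
      codeBounded-pendant <$> recurse x∈p-y⇒x∈p (s , s∈S , x∉p-x) twinFree′
      where open Pendant twinFree s∈S pendant

  isIDCode⇒twinFree : ∀ {C} → IsIDCode G C → TwinFreeIn ⊤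
  isIDCode⇒twinFree (_ , separated) u v _ _ u≢v = decidable-stable (separator? ⊤ u v) λ inseparable →
    separated u v u≢v λ w → mk⇔
      (λ (w∈C , u∼w) → w∈C , inseparable⇒closedAdj inseparable ∈⊤ u∼w)
      (λ (w∈C , v∼w) → w∈C , inseparable⇒closedAdj (inseparable-sym inseparable) ∈⊤ v∼w)

  isIDCodeIn⊤⇒isIDCode : ∀ {C} → IsIDCodeIn ⊤ C → IsIDCode G C
  isIDCodeIn⊤⇒isIDCode (_ , dominated , separated) = (λ u → dominated u ∈⊤) , λ u v u≢v same →
    case separated u v ∈⊤ ∈⊤ u≢v of λ where
      (w , w∈C , inj₁ (u∼w , v≁w)) → v≁w (proj₂ (Equivalence.to (same w) (w∈C , u∼w)))
      (w , w∈C , inj₂ (u≁w , v∼w)) → u≁w (proj₂ (Equivalence.from (same w) (w∈C , v∼w)))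

  maximalCliqueIn⊤⇒isMaximalClique : ∀ {T} → MaximalCliqueIn ⊤ T → IsMaximalClique G T
  maximalCliqueIn⊤⇒isMaximalClique (_ , nonempty , clique , maximal) =
    nonempty , clique , λ T′ cliqueT′ T⊆T′ → maximal T′ ⊆⊤ cliqueT′ T⊆T′

  ¬¬-code≤cliques : IsBlockGraph G → Identifiable G → ∀ {Qs} → EnumeratesMaxCliques G Qs →
                     DoubleNegation (∃ λ C → IsIDCodeIn ⊤ C × ∣ C ∣ ≤ length Qs)
  ¬¬-code≤cliques blockGraph (_ , code₀) (_ , enumerates) = do
    C , code , Ts , unique , maximal , ∣C∣≤∣Ts∣ ←
      ¬¬-codeBoundedByCliques blockGraph n (∣p∣≤n ⊤) (isIDCode⇒twinFree code₀)
    pure (C , code , ≤-trans ∣C∣≤∣Ts∣ (unique∧⊆⇒length≤ unique λ T∈Ts →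
      Equivalence.from (enumerates _) (maximalCliqueIn⊤⇒isMaximalClique (All.lookup maximal T∈Ts))))

mainTheorem1 : (n : ℕ) (G : Graph n) → IsBlockGraph G → Identifiable G →
    (Qs : List (Subset n)) → EnumeratesMaxCliques G Qs →
    γID≤ G (length Qs)
mainTheorem1 n G blockGraph identifiable Qs enumerates =
  let C , code , ∣C∣≤∣Qs∣ = decidable-stable (anySubset? λ C → isIDCodeIn? G ⊤ C ×-dec ∣ C ∣ ≤? length Qs)
                                             (¬¬-code≤cliques G blockGraph identifiable enumerates)
  in C , isIDCodeIn⊤⇒isIDCode G code , ∣C∣≤∣Qs∣
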